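{- Let $T,Q$ be integers with $Q\ne0$, and let $a,P,R$ be integers with $a$ nonzero and squarefree, $R\neq 0$, $\gcd(P,R)=\gcd(a,R)=1$, and $T^2R=aP^2Q$. Let $q=\frac{T^2}{Q}-2$. Then $\Pi_s(T,Q)=\Pi_s(q)$ for all $s=0,1,2,\dots$.
   Context: Dickson polynomials: for integers $T,Q$, $L_0(T,Q)=0$, $L_1(T,Q)=1$, $L_{n+1}=TL_n-QL_{n-1}$ (so for a $2\times2$ matrix $A$ with trace $T$ and determinant $Q$, $A^n=L_nA-QL_{n-1}I$), and $K_n=L_{n+1}-QL_{n-1}$ (the trace of $A^n$). Definition of $\Pi_s(T,Q)$ (relative to the chosen $a,P,R$): it consists of odd primes $p\nmid R$; if $p\mid a$ then $p$ is placed in $\Pi_1(T,Q)$ (and in no other $\Pi_s(T,Q)$); if $p\nmid a$, then $p\in\Pi_0(T,Q)$ iff $p\mid L_n(aP,aR)$ for some odd $n\ge1$, and $p\in\Pi_s(T,Q)$ ($s\ge1$) iff $p\mid K_{2^{s-1}n}(aP,aR)$ for some odd $n\ge1$. Chebyshev polynomials: $U_0=0$, $U_1=1$, $U_{n+1}=qU_n-U_{n-1}$; $C_n=U_{n+1}-U_{n-1}$; for odd $n=2k+1$, $V_n=U_{k+1}-U_k$, $W_n=U_{k+1}+U_k$. For a rational $q=c/d$ in lowest terms and an odd prime $p\nmid d$ (congruences in $\mathbb F_p$): $p\in\Pi_0(q)$ if $W_n(q)\equiv0$ for some odd $n\ge1$; $p\in\Pi_1(q)$ if $V_n(q)\equiv0$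 for some odd $n\ge1$; $p\in\Pi_{2+k}(q)$ ($k\ge0$) if $C_{2^kn}(q)\equiv0$ for some odd $n\ge1$. -}

module Defs where

open import Data.Nat as ℕ using (ℕ; zero; suc)
open import Data.Nat.Primality using (Prime)
import Data.Nat.Divisibility as ℕD
open import Data.Integer as ℤ using (ℤ; +_; _+_; _-_; _*_; ∣_∣; sign; _◃_)
open import Data.Integer.Divisibility using (_∣_)
open import Data.Rational as ℚ using (ℚ; ↥_; ↧_)
open import Data.Product using (_×_; ∃-syntax)
open import Data.Sum using (_⊎_)
open import Relation.Nullary using (¬_)
open import Relation.Binary.PropositionalEquality using (_≡_)

odd : ℕ → ℕ
odd k = 2 ℕ.* k ℕ.+ 1

OddPrime : ℕ → Set
OddPrime p = Prime p × ¬ (2 ℕD.∣ p)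

SquareFree : ℤ → Set
SquareFree a = ∀ (d : ℤ) → (d * d) ∣ a → d ∣ ℤ.1ℤ

L : ℤ → ℤ → ℕ → ℤ
L T Q zero = ℤ.0ℤ
L T Q (suc zero) = ℤ.1ℤ
L T Q (suc (suc n)) = T * L T Q (suc n) - Q * L T Q n

-- K_n = L_{n+1} - Q L_{n-1}   (K_0 = 2, the trace of the identity)
K : ℤ → ℤ → ℕ → ℤ
K T Q zero = + 2
K T Q (suc n) = L T Q (suc (suc n)) - Q * L T Q n

DicksonCond : ℤ → ℤ → ℕ → ℕ → Set
DicksonCond T Q zero    p = ∃[ k ] (+ p ∣ L T Q (odd k))
DicksonCond T Q (suc t) p = ∃[ k ] (+ p ∣ K T Q (2 ℕ.^ t ℕ.* odd k))

-- Π_s(T,Q), relative to the chosen a, P, R  (the arguments T Q are only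
-- notational: the definition depends on a, P, R as in the paper)
ΠTQ : (T Q a P R : ℤ) → ℕ → ℕ → Set
ΠTQ T Q a P R s p =
  OddPrime p × ¬ (+ p ∣ R) ×
  ((+ p ∣ a × s ≡ 1) ⊎ (¬ (+ p ∣ a) × DicksonCond (a * P) (a * R) s p))

U : ℤ → ℕ → ℤ
U x zero = ℤ.0ℤ
U x (suc zero) = ℤ.1ℤ
U x (suc (suc n)) = x * U x (suc n) - U x n

C : ℤ → ℕ → ℤ
C x zero = + 2
C x (suc n) = U x (suc (suc n)) - U x n

-- V k = V_{2k+1} = U_{k+1} - U_k ;  W k = W_{2k+1} = U_{k+1} + U_k
V : ℤ → ℕ → ℤ
V x k = U x (suc k) - U x k

W : ℤ → ℕ → ℤ
W x k = U x (suc k) + U x k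

ChebCond : ℕ → ℤ → ℕ → Set
ChebCond zero          x p = ∃[ k ] (+ p ∣ W x k)
ChebCond (suc zero)    x p = ∃[ k ] (+ p ∣ V x k)
ChebCond (suc (suc j)) x p = ∃[ k ] (+ p ∣ C x (2 ℕ.^ j ℕ.* odd k))

-- Π_s(q) for q = c/d in lowest terms (c = ↥ q, d = ↧ q > 0):
-- odd primes p ∤ d such that the condition holds in 𝔽_p at the image of q,
-- i.e. at any integer x with d x ≡ c (mod p).
Πq : ℚ → ℕ → ℕ → Set
Πq q s p =
  OddPrime p × ¬ (+ p ∣ ↧ q) ×
  ∃[ x ] ((+ p ∣ ((↧ q) * x - ↥ q)) × ChebCond s x p)

-- q = T²/Q - 2 = (T² - 2Q)/Q = sign(Q)(T² - 2Q) / |Q|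
qOf : (T Q : ℤ) → .{{ℤ.NonZero Q}} → ℚ
qOf T Q = ((T * T - + 2 * Q) * (sign Q ◃ 1)) ℚ./ ∣ Q ∣

{-# OPTIONS --safe #-}
module Submission where

-- Write q = c/d in lowest terms.  From T²R = aP²Q one gets cR = d(aP² − 2R); for an odd
-- prime p this gives, using gcd(P,R) = gcd(a,R) = 1, that p ∤ d exactly when p ∤ R, and
-- then the image x of q in 𝔽_p is the root of R x = aP² − 2R.  With T = aP and Q = aR the
-- root satisfies T² = Q(x + 2), which turns the Dickson recurrences into the Chebyshev
-- ones: L_{2k+1} = Q^k W_k(x), L_{2k+2} = T Q^k U_{k+1}(x), K_{2k+1} = T Q^k V_k(x) and
-- K_{2n} = Q^n C_n(x) in 𝔽_p.  When p ∤ aP the factors in front are units, so the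
-- conditions defining Π_s match index by index.  When p ∣ aP we have x = −2, where
-- W_k = ±1, C_n = ±2 and V_k = ±(2k+1), so on the Chebyshev side exactly s = 1 holds
-- (take 2k + 1 = p); on the Dickson side p ∈ Π_1 by definition when p ∣ a, and through
-- K_1 = aP when p ∣ P.

open import Defs
open import Data.Nat as ℕ using (ℕ; zero; suc)
import Data.Nat.Properties as ℕ
import Data.Nat.Divisibility as ℕD
open import Data.Nat.Primality
  using (Prime; euclidsLemma; irreducible[2]; prime⇒irreducible; prime⇒nonTrivial)
open import Data.Nat.GCD using (module Bézout)
open import Data.Nat.Coprimality as Coprimality using (Coprime; coprime-Bézout)
open import Data.Integer
  using (ℤ; _*_; 0ℤ; 1ℤ; -1ℤ; NonZero; +_; +[1+_]; -[1+_]; -_; _+_; _-_; _^_; ∣_∣)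
import Data.Integer.Properties as ℤ
open import Data.Integer.Divisibility using (_∣_)
import Data.Integer.Divisibility.Signed as Signed
open import Data.Integer.GCD using (gcd; gcd-greatest)
open import Data.Integer.Tactic.RingSolver using (solve-∀)
open import Data.Rational as ℚ using (ℚ; mkℚ; ↥_; ↧_)
import Data.Rational.Properties as ℚ
open import Data.Product as Product using (_×_; _,_; proj₁; proj₂; ∃-syntax)
open import Data.Sum as Sum using (_⊎_; inj₁; inj₂; [_,_]′)
open import Data.Empty using (⊥-elim)
open import Function using (_∘_; id; flip)
open import Function.Bundles using (_⇔_; mk⇔; Equivalence)
import Function.Properties.Equivalence as ⇔
open import Level using (0ℓ)
open import Relation.Nullary using (¬_; yes; no)
open import Relation.Binary.Bundles using (Setoid)
open import Relation.Binary.Structures using (IsEquivalence)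
open import Relation.Binary.PropositionalEquality
  using (_≡_; _≢_; refl; sym; trans; cong; subst; subst₂; module ≡-Reasoning)

-- A record rather than a synonym for divisibility, so that x, y and m can be inferred.
infix 4 _≡_mod_
record _≡_mod_ (x y m : ℤ) : Set where
  constructor ∣-difference
  field m∣x-y : m Signed.∣ x - y

open _≡_mod_

module _ {m : ℤ} where

  mod-reflexive : ∀ {x y} → x ≡ y → x ≡ y mod m
  mod-reflexive {x} refl = ∣-difference (Signed.divides 0ℤ (ℤ.+-inverseʳ x))

  mod-refl : ∀ {x} → x ≡ x mod m
  mod-refl = mod-reflexive refl

  mod-sym : ∀ {x y} → x ≡ y mod m → y ≡ x mod m
  mod-sym {x} {y} (∣-difference h) =
    ∣-difference (subst (m Signed.∣_) (swap x y) (Signed.∣m⇒∣-m h))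
    where
    swap : ∀ x y → - (x - y) ≡ y - x
    swap = solve-∀

  mod-trans : ∀ {x y z} → x ≡ y mod m → y ≡ z mod m → x ≡ z mod m
  mod-trans {x} {y} {z} (∣-difference h) (∣-difference h′) =
    ∣-difference (subst (m Signed.∣_) (telescope x y z) (Signed.∣m∣n⇒∣m+n h h′))
    where
    telescope : ∀ x y z → (x - y) + (y - z) ≡ x - z
    telescope = solve-∀

  mod-+-cong : ∀ {x y u v} → x ≡ y mod m → u ≡ v mod m → x + u ≡ y + v mod m
  mod-+-cong {x} {y} {u} {v} (∣-difference h) (∣-difference h′) =
    ∣-difference (subst (m Signed.∣_) (regroup x y u v) (Signed.∣m∣n⇒∣m+n h h′))
    where
    regroup : ∀ x y u v → (x - y) + (u - v) ≡ (x + u) - (y + v)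
    regroup = solve-∀

  mod-neg-cong : ∀ {x y} → x ≡ y mod m → - x ≡ - y mod m
  mod-neg-cong {x} {y} (∣-difference h) =
    ∣-difference (subst (m Signed.∣_) (neg-sub x y) (Signed.∣m⇒∣-m h))
    where
    neg-sub : ∀ x y → - (x - y) ≡ - x - - y
    neg-sub = solve-∀

  mod-*-congˡ : ∀ z {x y} → x ≡ y mod m → z * x ≡ z * y mod m
  mod-*-congˡ z {x} {y} (∣-difference h) =
    ∣-difference (subst (m Signed.∣_) (distrib z x y) (Signed.∣n⇒∣m*n z h))
    where
    distrib : ∀ z x y → z * (x - y) ≡ z * x - z * y
    distrib = solve-∀

  mod-*-cong : ∀ {x y u v} → x ≡ y mod m → u ≡ v mod m → x * u ≡ y * v mod m
  mod-*-cong {x} {y} {u} {v} h h′ = mod-trans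
    (subst₂ (_≡_mod m) (ℤ.*-comm u x) (ℤ.*-comm u y) (mod-*-congˡ u h))
    (mod-*-congˡ y h′)

mod-isEquivalence : ∀ {m} → IsEquivalence (_≡_mod m)
mod-isEquivalence = record { refl = mod-refl ; sym = mod-sym ; trans = mod-trans }

mod-setoid : ℤ → Setoid 0ℓ 0ℓ
mod-setoid m = record { isEquivalence = mod-isEquivalence {m} }

reindex : ∀ {m} (f : ℕ → ℤ) {i j y} → i ≡ j → f j ≡ y mod m → f i ≡ y mod m
reindex f refl h = h

∣⇒≡0 : ∀ {m z} → m ∣ z → z ≡ 0ℤ mod m
∣⇒≡0 {z = z} h = ∣-difference (subst (_ Signed.∣_) (sym (ℤ.+-identityʳ z)) (Signed.∣ᵤ⇒∣ h))

∣⇒mod : ∀ {m x y} → m ∣ x - y → x ≡ y mod m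
∣⇒mod = ∣-difference ∘ Signed.∣ᵤ⇒∣

mod⇒∣ : ∀ {m x y} → x ≡ y mod m → m ∣ x - y
mod⇒∣ = Signed.∣⇒∣ᵤ ∘ m∣x-y

≡0⇒∣ : ∀ {m z} → z ≡ 0ℤ mod m → m ∣ z
≡0⇒∣ {z = z} (∣-difference h) = Signed.∣⇒∣ᵤ (subst (_ Signed.∣_) (ℤ.+-identityʳ z) h)

≡⇒-≡0 : ∀ {m x y} → x ≡ y mod m → x - y ≡ 0ℤ mod m
≡⇒-≡0 {x = x} {y} (∣-difference h) =
  ∣-difference (subst (_ Signed.∣_) (sym (ℤ.+-identityʳ (x - y))) h)

-≡0⇒≡ : ∀ {m x y} → x - y ≡ 0ℤ mod m → x ≡ y mod m
-≡0⇒≡ {x = x} {y} (∣-difference h) = ∣-difference (subst (_ Signed.∣_) (ℤ.+-identityʳ (x - y)) h)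

odd-suc : ∀ k → odd (suc k) ≡ suc (suc (odd k))
odd-suc k = cong (ℕ._+ 1) (ℕ.*-suc 2 k)

double-suc : ∀ n → 2 ℕ.* suc n ≡ suc (odd n)
double-suc n = trans (ℕ.*-suc 2 n) (cong suc (ℕ.+-comm 1 (2 ℕ.* n)))

even-or-odd : ∀ n → 2 ℕD.∣ n ⊎ ∃[ k ] n ≡ odd k
even-or-odd zero = inj₁ (2 ℕD.∣0)
even-or-odd (suc zero) = inj₂ (0 , refl)
even-or-odd (suc (suc n)) =
  Sum.map (ℕD.∣m∣n⇒∣m+n ℕD.∣-refl)
          (Product.map suc (λ {k} eq → trans (cong (suc ∘ suc) eq) (sym (odd-suc k))))
          (even-or-odd n)

odd-as-ℤ : ∀ k → + odd k ≡ + 2 * + k + 1ℤ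
odd-as-ℤ k = trans (ℤ.pos-+ (2 ℕ.* k) 1) (cong (_+ 1ℤ) (ℤ.pos-* 2 k))

module DicksonChebyshev {m : ℤ} (T Q x : ℤ) (root : T * T ≡ Q * (x + + 2) mod m) where

  open import Relation.Binary.Reasoning.Setoid (mod-setoid m)

  mutual
    L-odd : ∀ k → L T Q (odd k) ≡ Q ^ k * W x k mod m
    L-odd zero = mod-refl
    L-odd (suc k) = reindex (L T Q) (odd-suc k) (L-odd-step k)

    L-even : ∀ k → L T Q (suc (odd k)) ≡ T * Q ^ k * U x (suc k) mod m
    L-even zero = mod-reflexive (L₂ T Q)
      where
      L₂ : ∀ T Q → T * 1ℤ - Q * 0ℤ ≡ T * 1ℤ * 1ℤ
      L₂ = solve-∀
    L-even (suc k) = reindex (L T Q) (cong suc (odd-suc k)) (L-even-step k)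

    L-odd-step : ∀ k → L T Q (suc (suc (odd k))) ≡ Q ^ suc k * W x (suc k) mod m
    L-odd-step k = begin
      T * L T Q (suc (odd k)) - Q * L T Q (odd k)
        ≈⟨ mod-+-cong (mod-*-congˡ T (L-even k)) (mod-neg-cong (mod-*-congˡ Q (L-odd k))) ⟩
      T * (T * Q ^ k * U x (suc k)) - Q * (Q ^ k * W x k)
        ≡⟨ factor T Q (Q ^ k) (U x (suc k)) (W x k) ⟩
      Q ^ k * (T * T * U x (suc k) - Q * W x k)
        ≈⟨ mod-*-congˡ (Q ^ k) (mod-+-cong (mod-*-cong root mod-refl) mod-refl) ⟩
      Q ^ k * (Q * (x + + 2) * U x (suc k) - Q * W x k)
        ≡⟨ recurrence Q x (Q ^ k) (U x (suc k)) (U x k) ⟩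
      Q ^ suc k * W x (suc k) ∎
      where
      factor : ∀ T Q q u w → T * (T * q * u) - Q * (q * w) ≡ q * (T * T * u - Q * w)
      factor = solve-∀
      recurrence : ∀ Q x q u₁ u₀ →
        q * (Q * (x + + 2) * u₁ - Q * (u₁ + u₀)) ≡ Q * q * ((x * u₁ - u₀) + u₁)
      recurrence = solve-∀

    L-even-step : ∀ k → L T Q (suc (suc (suc (odd k)))) ≡ T * Q ^ suc k * U x (suc (suc k)) mod m
    L-even-step k = begin
      T * L T Q (suc (suc (odd k))) - Q * L T Q (suc (odd k))
        ≈⟨ mod-+-cong (mod-*-congˡ T (L-odd-step k)) (mod-neg-cong (mod-*-congˡ Q (L-even k))) ⟩
      T * (Q ^ suc k * W x (suc k)) - Q * (T * Q ^ k * U x (suc k))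
        ≡⟨ cancel T Q (Q ^ k) (U x (suc (suc k))) (U x (suc k)) ⟩
      T * Q ^ suc k * U x (suc (suc k)) ∎
      where
      cancel : ∀ T Q q u₂ u₁ → T * (Q * q * (u₂ + u₁)) - Q * (T * q * u₁) ≡ T * (Q * q) * u₂
      cancel = solve-∀

  K-odd : ∀ k → K T Q (odd k) ≡ T * Q ^ k * V x k mod m
  K-odd zero = mod-reflexive (trace₁ T Q)
    where
    trace₁ : ∀ T Q → (T * 1ℤ - Q * 0ℤ) - Q * 0ℤ ≡ T * 1ℤ * (1ℤ - 0ℤ)
    trace₁ = solve-∀
  K-odd (suc k) = reindex (K T Q) (odd-suc k) (begin
    L T Q (suc (suc (suc (odd k)))) - Q * L T Q (suc (odd k))
      ≈⟨ mod-+-cong (L-even-step k) (mod-neg-cong (mod-*-congˡ Q (L-even k))) ⟩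
    T * Q ^ suc k * U x (suc (suc k)) - Q * (T * Q ^ k * U x (suc k))
      ≡⟨ factor T Q (Q ^ k) (U x (suc (suc k))) (U x (suc k)) ⟩
    T * Q ^ suc k * V x (suc k) ∎)
    where
    factor : ∀ T Q q u₂ u₁ → T * (Q * q) * u₂ - Q * (T * q * u₁) ≡ T * (Q * q) * (u₂ - u₁)
    factor = solve-∀

  K-even : ∀ n → K T Q (2 ℕ.* n) ≡ Q ^ n * C x n mod m
  K-even zero = mod-refl
  K-even (suc n) = reindex (K T Q) (double-suc n) (begin
    L T Q (suc (suc (odd n))) - Q * L T Q (odd n)
      ≈⟨ mod-+-cong (L-odd-step n) (mod-neg-cong (mod-*-congˡ Q (L-odd n))) ⟩
    Q ^ suc n * W x (suc n) - Q * (Q ^ n * W x n)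
      ≡⟨ factor Q (Q ^ n) (U x (suc (suc n))) (U x (suc n)) (U x n) ⟩
    Q ^ suc n * C x (suc n) ∎)
    where
    factor : ∀ Q q u₂ u₁ u₀ → Q * q * (u₂ + u₁) - Q * (q * (u₁ + u₀)) ≡ Q * q * (u₂ - u₀)
    factor = solve-∀

module ChebyshevAtMinusTwo {m x : ℤ} (x≡-2 : x ≡ - + 2 mod m) where

  open import Relation.Binary.Reasoning.Setoid (mod-setoid m)

  U-at-−2 : ∀ n → U x n ≡ - (-1ℤ ^ n * + n) mod m
  U-at-−2 zero = mod-refl
  U-at-−2 (suc zero) = mod-refl
  U-at-−2 (suc (suc n)) = begin
    x * U x (suc n) - U x n
      ≈⟨ mod-+-cong (mod-*-cong x≡-2 (U-at-−2 (suc n))) (mod-neg-cong (U-at-−2 n)) ⟩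
    - + 2 * - (-1ℤ ^ suc n * + suc n) - - (-1ℤ ^ n * + n)
      ≡⟨ recurrence (-1ℤ ^ n) (+ n) ⟩
    - (-1ℤ ^ suc (suc n) * + suc (suc n)) ∎
    where
    recurrence : ∀ s N →
      - + 2 * - (-1ℤ * s * (1ℤ + N)) - - (s * N) ≡ - (-1ℤ * (-1ℤ * s) * (1ℤ + (1ℤ + N)))
    recurrence = solve-∀

  W-at-−2 : ∀ k → W x k ≡ -1ℤ ^ k mod m
  W-at-−2 k = begin
    U x (suc k) + U x k
      ≈⟨ mod-+-cong (U-at-−2 (suc k)) (U-at-−2 k) ⟩
    - (-1ℤ ^ suc k * + suc k) + - (-1ℤ ^ k * + k)
      ≡⟨ telescope (-1ℤ ^ k) (+ k) ⟩
    -1ℤ ^ k ∎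
    where
    telescope : ∀ s N → - (-1ℤ * s * (1ℤ + N)) + - (s * N) ≡ s
    telescope = solve-∀

  V-at-−2 : ∀ k → V x k ≡ -1ℤ ^ k * + odd k mod m
  V-at-−2 k = begin
    U x (suc k) - U x k
      ≈⟨ mod-+-cong (U-at-−2 (suc k)) (mod-neg-cong (U-at-−2 k)) ⟩
    - (-1ℤ ^ suc k * + suc k) - - (-1ℤ ^ k * + k)
      ≡⟨ collect (-1ℤ ^ k) (+ k) ⟩
    -1ℤ ^ k * (+ 2 * + k + 1ℤ)
      ≡⟨ cong (-1ℤ ^ k *_) (odd-as-ℤ k) ⟨
    -1ℤ ^ k * + odd k ∎
    where
    collect : ∀ s N → - (-1ℤ * s * (1ℤ + N)) - - (s * N) ≡ s * (+ 2 * N + 1ℤ)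
    collect = solve-∀

  C-at-−2 : ∀ n → C x n ≡ + 2 * -1ℤ ^ n mod m
  C-at-−2 zero = mod-refl
  C-at-−2 (suc n) = begin
    U x (suc (suc n)) - U x n
      ≈⟨ mod-+-cong (U-at-−2 (suc (suc n))) (mod-neg-cong (U-at-−2 n)) ⟩
    - (-1ℤ ^ suc (suc n) * + suc (suc n)) - - (-1ℤ ^ n * + n)
      ≡⟨ telescope (-1ℤ ^ n) (+ n) ⟩
    + 2 * -1ℤ ^ suc n ∎
    where
    telescope : ∀ s N → - (-1ℤ * (-1ℤ * s) * (1ℤ + (1ℤ + N))) - - (s * N) ≡ + 2 * (-1ℤ * s)
    telescope = solve-∀

↥[i/n]*n≡↧[i/n]*i : ∀ i n .{{_ : ℕ.NonZero n}} → ↥ (i ℚ./ n) * + n ≡ ↧ (i ℚ./ n) * i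
↥[i/n]*n≡↧[i/n]*i i n = begin
  ↥ q * + n         ≡⟨ cong (↥ q *_) (ℚ.↧-/ i n) ⟨
  ↥ q * (↧ q * g)   ≡⟨ swap (↥ q) (↧ q) g ⟩
  ↧ q * (↥ q * g)   ≡⟨ cong (↧ q *_) (ℚ.↥-/ i n) ⟩
  ↧ q * i           ∎
  where
  open ≡-Reasoning
  q : ℚ
  q = i ℚ./ n
  g : ℤ
  g = gcd i (+ n)
  swap : ∀ a b c → a * (b * c) ≡ b * (a * c)
  swap = solve-∀

↥↧-coprime : ∀ q → Coprime ∣ ↥ q ∣ ∣ ↧ q ∣
↥↧-coprime (mkℚ _ _ coprime) = Coprimality.recompute coprime

qOf-cross : ∀ T Q .{{_ : NonZero Q}} → ↥ (qOf T Q) * Q ≡ ↧ (qOf T Q) * (T * T - + 2 * Q)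
qOf-cross T Q@(+[1+ n ]) =
  trans (↥[i/n]*n≡↧[i/n]*i _ (suc n)) (cong (↧ (qOf T Q) *_) (ℤ.*-identityʳ (T * T - + 2 * Q)))
qOf-cross T Q@(-[1+ n ]) = begin
  ↥ q * - + suc n         ≡⟨ negate (↥ q) (+ suc n) ⟩
  - (↥ q * + suc n)       ≡⟨ cong -_ (↥[i/n]*n≡↧[i/n]*i _ (suc n)) ⟩
  - (↧ q * (X * -1ℤ))     ≡⟨ unnegate (↧ q) X ⟩
  ↧ q * X                 ∎
  where
  open ≡-Reasoning
  q : ℚ
  q = qOf T Q
  X : ℤ
  X = T * T - + 2 * Q
  negate : ∀ c n → c * - n ≡ - (c * n)
  negate = solve-∀
  unnegate : ∀ d X → - (d * (X * -1ℤ)) ≡ d * X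
  unnegate = solve-∀

qOf-cross-R : ∀ T Q a P R .{{_ : NonZero Q}} → T * T * R ≡ a * P * P * Q →
              ↥ (qOf T Q) * R ≡ ↧ (qOf T Q) * (a * P * P - + 2 * R)
qOf-cross-R T Q a P R T²R≡aP²Q = ℤ.*-cancelˡ-≡ Q _ _ (begin
  Q * (c * R)                              ≡⟨ swap Q c R ⟩
  c * Q * R                                ≡⟨ cong (_* R) (qOf-cross T Q) ⟩
  d * (T * T - + 2 * Q) * R                ≡⟨ expand d (T * T) Q R ⟩
  d * (T * T * R) - d * (+ 2 * Q * R)      ≡⟨ cong (λ t → d * t - d * (+ 2 * Q * R)) T²R≡aP²Q ⟩
  d * (a * P * P * Q) - d * (+ 2 * Q * R)  ≡⟨ collect d (a * P * P) Q R ⟩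
  Q * (d * (a * P * P - + 2 * R))          ∎)
  where
  open ≡-Reasoning
  c d : ℤ
  c = ↥ (qOf T Q)
  d = ↧ (qOf T Q)
  swap : ∀ Q c R → Q * (c * R) ≡ c * Q * R
  swap = solve-∀
  expand : ∀ d S Q R → d * (S - + 2 * Q) * R ≡ d * (S * R) - d * (+ 2 * Q * R)
  expand = solve-∀
  collect : ∀ d A Q R → d * (A * Q) - d * (+ 2 * Q * R) ≡ Q * (d * (A - + 2 * R))
  collect = solve-∀

module PrimeModulus {p : ℕ} (prime : Prime p) where

  1≢0 : ¬ 1ℤ ≡ 0ℤ mod + p
  1≢0 1≡0 = ℕ.nonTrivial⇒≢1 {{prime⇒nonTrivial prime}} (ℕD.∣1⇒≡1 (≡0⇒∣ 1≡0))

  *-≡0-split : ∀ x y → x * y ≡ 0ℤ mod + p → x ≡ 0ℤ mod + p ⊎ y ≡ 0ℤ mod + p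
  *-≡0-split x y xy≡0 = Sum.map ∣⇒≡0 ∣⇒≡0
    (euclidsLemma ∣ x ∣ ∣ y ∣ prime (subst (p ℕD.∣_) (ℤ.abs-* x y) (≡0⇒∣ xy≡0)))

  *-≢0 : ∀ {x y} → ¬ x ≡ 0ℤ mod + p → ¬ y ≡ 0ℤ mod + p → ¬ x * y ≡ 0ℤ mod + p
  *-≢0 {x} {y} x≢0 y≢0 xy≡0 = [ x≢0 , y≢0 ]′ (*-≡0-split x y xy≡0)

  ^-≢0 : ∀ {x} → ¬ x ≡ 0ℤ mod + p → ∀ k → ¬ x ^ k ≡ 0ℤ mod + p
  ^-≢0 x≢0 zero = 1≢0
  ^-≢0 x≢0 (suc k) = *-≢0 x≢0 (^-≢0 x≢0 k)

  *-cancelˡ-mod : ∀ {u x y} → ¬ u ≡ 0ℤ mod + p → u * x ≡ u * y mod + p → x ≡ y mod + p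
  *-cancelˡ-mod {u} {x} {y} u≢0 ux≡uy =
    -≡0⇒≡ ([ ⊥-elim ∘ u≢0 , id ]′ (*-≡0-split u (x - y) u[x-y]≡0))
    where
    distrib : ∀ u x y → u * (x - y) ≡ u * x - u * y
    distrib = solve-∀
    u[x-y]≡0 : u * (x - y) ≡ 0ℤ mod + p
    u[x-y]≡0 = mod-trans (mod-reflexive (distrib u x y)) (≡⇒-≡0 ux≡uy)

  unit-multiple-≡0⇔ : ∀ {A u B} → ¬ u ≡ 0ℤ mod + p → A ≡ u * B mod + p →
                      (A ≡ 0ℤ mod + p) ⇔ (B ≡ 0ℤ mod + p)
  unit-multiple-≡0⇔ {A} {u} {B} u≢0 A≡uB = mk⇔
    (λ A≡0 → [ ⊥-elim ∘ u≢0 , id ]′ (*-≡0-split u B (mod-trans (mod-sym A≡uB) A≡0)))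
    (λ B≡0 → mod-trans A≡uB (mod-trans (mod-*-congˡ u B≡0) (mod-reflexive (ℤ.*-zeroʳ u))))

  ∃-unit-multiple-∣⇔ : ∀ {A u B : ℕ → ℤ} → (∀ k → ¬ u k ≡ 0ℤ mod + p) →
                       (∀ k → A k ≡ u k * B k mod + p) → (∃[ k ] (+ p ∣ A k)) ⇔ (∃[ k ] (+ p ∣ B k))
  ∃-unit-multiple-∣⇔ {A} {u} {B} u≢0 A≡uB = mk⇔
    (Product.map₂ λ {k} → ≡0⇒∣ ∘ Equivalence.to (A≡0⇔B≡0 k) ∘ ∣⇒≡0)
    (Product.map₂ λ {k} → ≡0⇒∣ ∘ Equivalence.from (A≡0⇔B≡0 k) ∘ ∣⇒≡0)
    where
    A≡0⇔B≡0 : ∀ k → (A k ≡ 0ℤ mod + p) ⇔ (B k ≡ 0ℤ mod + p)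
    A≡0⇔B≡0 k = unit-multiple-≡0⇔ (u≢0 k) (A≡uB k)

  gcd≡1⇒¬both≡0 : ∀ {i j} → gcd i j ≡ 1ℤ → i ≡ 0ℤ mod + p → ¬ j ≡ 0ℤ mod + p
  gcd≡1⇒¬both≡0 {i} {j} gcd≡1 i≡0 j≡0 =
    1≢0 (∣⇒≡0 (subst (+ p ∣_) gcd≡1 (gcd-greatest {i} {j} {+ p} (≡0⇒∣ i≡0) (≡0⇒∣ j≡0))))

  coprime⇒¬both≡0 : ∀ {i j} → Coprime ∣ i ∣ ∣ j ∣ → i ≡ 0ℤ mod + p → ¬ j ≡ 0ℤ mod + p
  coprime⇒¬both≡0 coprime i≡0 j≡0 =
    ℕ.nonTrivial⇒≢1 {{prime⇒nonTrivial prime}} (coprime (≡0⇒∣ i≡0 , ≡0⇒∣ j≡0))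

  inverse : ∀ {r} → ¬ r ≡ 0ℤ mod + p → ∃[ u ] u * r ≡ 1ℤ mod + p
  inverse {r} r≢0 = unsign r (Bézout-inverse (coprime-Bézout coprime))
    where
    coprime : Coprime ∣ r ∣ p
    coprime (d∣r , d∣p) =
      [ id , (λ { refl → ⊥-elim (r≢0 (∣⇒≡0 d∣r)) }) ]′ (prime⇒irreducible prime d∣p)

    lift : ∀ a b c d → 1 ℕ.+ a ℕ.* b ≡ c ℕ.* d → 1ℤ + + a * + b ≡ + c * + d
    lift a b c d eq =
      trans (cong (λ t → 1ℤ + t) (sym (ℤ.pos-* a b))) (trans (cong +_ eq) (ℤ.pos-* c d))

    Bézout-inverse : Bézout.Identity 1 ∣ r ∣ p → ∃[ u ] u * + ∣ r ∣ ≡ 1ℤ mod + p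
    Bézout-inverse (Bézout.+- a b eq) = + a , ∣-difference (Signed.divides (+ b) (begin
      + a * + ∣ r ∣ - 1ℤ     ≡⟨ cong (_- 1ℤ) (lift b p a ∣ r ∣ eq) ⟨
      1ℤ + + b * + p - 1ℤ    ≡⟨ cancel (+ b * + p) ⟩
      + b * + p              ∎))
      where
      open ≡-Reasoning
      cancel : ∀ z → 1ℤ + z - 1ℤ ≡ z
      cancel = solve-∀
    Bézout-inverse (Bézout.-+ a b eq) = - + a , ∣-difference (Signed.divides (- + b) (begin
      - + a * + ∣ r ∣ - 1ℤ   ≡⟨ negate (+ a) (+ ∣ r ∣) ⟩
      - (1ℤ + + a * + ∣ r ∣) ≡⟨ cong -_ (lift a ∣ r ∣ b p eq) ⟩
      - (+ b * + p)          ≡⟨ ℤ.neg-distribˡ-* (+ b) (+ p) ⟩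
      - + b * + p            ∎))
      where
      open ≡-Reasoning
      negate : ∀ a n → - a * n - 1ℤ ≡ - (1ℤ + a * n)
      negate = solve-∀

    unsign : ∀ r → ∃[ u ] u * + ∣ r ∣ ≡ 1ℤ mod + p → ∃[ u ] u * r ≡ 1ℤ mod + p
    unsign (+ n) inv = inv
    unsign -[1+ n ] (u , u∣r∣≡1) = - u , subst (_≡ 1ℤ mod + p) (swap u -[1+ n ]) u∣r∣≡1
      where
      swap : ∀ u r → u * - r ≡ - u * r
      swap = solve-∀

  linear-root : ∀ {r} z → ¬ r ≡ 0ℤ mod + p → ∃[ x ] r * x ≡ z mod + p
  linear-root {r} z r≢0 with inverse r≢0
  ... | u , ur≡1 = u * z , (begin
    r * (u * z)   ≡⟨ regroup r u z ⟩
    u * r * z     ≈⟨ mod-*-cong ur≡1 mod-refl ⟩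
    1ℤ * z        ≡⟨ ℤ.*-identityˡ z ⟩
    z             ∎)
    where
    open import Relation.Binary.Reasoning.Setoid (mod-setoid (+ p))
    regroup : ∀ r u z → r * (u * z) ≡ u * r * z
    regroup = solve-∀

  fraction-root⇔ : ∀ {c d r z} x → c * r ≡ d * z → ¬ r ≡ 0ℤ mod + p → ¬ d ≡ 0ℤ mod + p →
                   (d * x ≡ c mod + p) ⇔ (r * x ≡ z mod + p)
  fraction-root⇔ {c} {d} {r} {z} x cr≡dz r≢0 d≢0 = mk⇔
    (λ dx≡c → *-cancelˡ-mod d≢0 (begin
      d * (r * x)   ≡⟨ swap d r x ⟩
      r * (d * x)   ≈⟨ mod-*-congˡ r dx≡c ⟩
      r * c         ≡⟨ ℤ.*-comm r c ⟩
      c * r         ≡⟨ cr≡dz ⟩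
      d * z         ∎))
    (λ rx≡z → *-cancelˡ-mod r≢0 (begin
      r * (d * x)   ≡⟨ swap r d x ⟩
      d * (r * x)   ≈⟨ mod-*-congˡ d rx≡z ⟩
      d * z         ≡⟨ cr≡dz ⟨
      c * r         ≡⟨ ℤ.*-comm c r ⟩
      r * c         ∎))
    where
    open import Relation.Binary.Reasoning.Setoid (mod-setoid (+ p))
    swap : ∀ a b x → a * (b * x) ≡ b * (a * x)
    swap = solve-∀

  denominator≡0⇔ : ∀ q a P {R} → gcd P R ≡ 1ℤ → gcd a R ≡ 1ℤ →
                   ↥ q * R ≡ ↧ q * (a * P * P - + 2 * R) → (↧ q ≡ 0ℤ mod + p) ⇔ (R ≡ 0ℤ mod + p)
  denominator≡0⇔ q a P {R} gcd[P,R]≡1 gcd[a,R]≡1 cR≡dZ = mk⇔ d≡0⇒R≡0 R≡0⇒d≡0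
    where
    c d : ℤ
    c = ↥ q
    d = ↧ q
    Z : ℤ
    Z = a * P * P - + 2 * R

    d≡0⇒R≡0 : d ≡ 0ℤ mod + p → R ≡ 0ℤ mod + p
    d≡0⇒R≡0 d≡0 =
      [ ⊥-elim ∘ flip (coprime⇒¬both≡0 (↥↧-coprime q)) d≡0 , id ]′ (*-≡0-split c R cR≡0)
      where
      cR≡0 : c * R ≡ 0ℤ mod + p
      cR≡0 = mod-trans (mod-reflexive cR≡dZ) (mod-*-cong d≡0 (mod-refl {x = Z}))

    aPP≢0 : R ≡ 0ℤ mod + p → ¬ a * P * P ≡ 0ℤ mod + p
    aPP≢0 R≡0 aPP≡0 =
      [ [ coprime-to-R⇒≢0 gcd[a,R]≡1 , coprime-to-R⇒≢0 gcd[P,R]≡1 ]′ ∘ *-≡0-split a P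
      , coprime-to-R⇒≢0 gcd[P,R]≡1
      ]′ (*-≡0-split (a * P) P aPP≡0)
      where
      coprime-to-R⇒≢0 : ∀ {i} → gcd i R ≡ 1ℤ → ¬ i ≡ 0ℤ mod + p
      coprime-to-R⇒≢0 gcd≡1 i≡0 = gcd≡1⇒¬both≡0 gcd≡1 i≡0 R≡0

    R≡0⇒d≡0 : R ≡ 0ℤ mod + p → d ≡ 0ℤ mod + p
    R≡0⇒d≡0 R≡0 = [ id , ⊥-elim ∘ aPP≢0 R≡0 ∘ Z≡0⇒aPP≡0 ]′ (*-≡0-split d Z dZ≡0)
      where
      dZ≡0 : d * Z ≡ 0ℤ mod + p
      dZ≡0 = mod-trans (mod-reflexive (sym cR≡dZ))
                       (mod-trans (mod-*-congˡ c R≡0) (mod-reflexive (ℤ.*-zeroʳ c)))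
      Z≡0⇒aPP≡0 : Z ≡ 0ℤ mod + p → a * P * P ≡ 0ℤ mod + p
      Z≡0⇒aPP≡0 Z≡0 = mod-trans (mod-reflexive (split (a * P * P) R))
                                (mod-+-cong Z≡0 (mod-*-congˡ (+ 2) R≡0))
        where
        split : ∀ A R → A ≡ (A - + 2 * R) + + 2 * R
        split = solve-∀

module OddPrimeModulus {p : ℕ} (odd-prime : OddPrime p) where

  open PrimeModulus (proj₁ odd-prime) public

  -1≢0 : ¬ -1ℤ ≡ 0ℤ mod + p
  -1≢0 = 1≢0 ∘ mod-neg-cong

  2≢0 : ¬ + 2 ≡ 0ℤ mod + p
  2≢0 2≡0 = [ ℕ.nonTrivial⇒≢1 {{prime⇒nonTrivial (proj₁ odd-prime)}}
            , (λ p≡2 → proj₂ odd-prime (subst (2 ℕD.∣_) (sym p≡2) ℕD.∣-refl)) ]′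
    (irreducible[2] (≡0⇒∣ 2≡0))

  p≡odd : ∃[ k ] p ≡ odd k
  p≡odd = [ ⊥-elim ∘ proj₂ odd-prime , id ]′ (even-or-odd p)

  ChebCond-at-−2 : ∀ {x} → x ≡ - + 2 mod + p → ∀ s → ChebCond s x p ⇔ s ≡ 1
  ChebCond-at-−2 {x} x≡-2 zero =
    mk⇔ (λ { (k , p∣W) → ⊥-elim (W≢0 k (∣⇒≡0 p∣W)) }) λ ()
    where
    open ChebyshevAtMinusTwo x≡-2
    W≢0 : ∀ k → ¬ W x k ≡ 0ℤ mod + p
    W≢0 k = ^-≢0 -1≢0 k ∘ mod-trans (mod-sym (W-at-−2 k))
  ChebCond-at-−2 {x} x≡-2 (suc zero) = mk⇔ (λ _ → refl) λ _ → k , ≡0⇒∣ V≡0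
    where
    open ChebyshevAtMinusTwo x≡-2
    k : ℕ
    k = proj₁ p≡odd
    V≡0 : V x k ≡ 0ℤ mod + p
    V≡0 = mod-trans (V-at-−2 k) (mod-trans
      (mod-*-congˡ (-1ℤ ^ k) (subst (λ n → + n ≡ 0ℤ mod + p) (proj₂ p≡odd) (∣⇒≡0 ℕD.∣-refl)))
      (mod-reflexive (ℤ.*-zeroʳ (-1ℤ ^ k))))
  ChebCond-at-−2 {x} x≡-2 (suc (suc j)) =
    mk⇔ (λ { (k , p∣C) → ⊥-elim (C≢0 (2 ℕ.^ j ℕ.* odd k) (∣⇒≡0 p∣C)) }) λ ()
    where
    open ChebyshevAtMinusTwo x≡-2
    C≢0 : ∀ n → ¬ C x n ≡ 0ℤ mod + p
    C≢0 n = *-≢0 2≢0 (^-≢0 -1≢0 n) ∘ mod-trans (mod-sym (C-at-−2 n))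

module AtRoot (a P R x : ℤ) {p : ℕ} (odd-prime : OddPrime p)
  (R≢0 : ¬ R ≡ 0ℤ mod + p) (root : R * x ≡ a * P * P - + 2 * R mod + p) where

  open OddPrimeModulus odd-prime
  open import Relation.Binary.Reasoning.Setoid (mod-setoid (+ p))

  dickson-root : a * P * (a * P) ≡ a * R * (x + + 2) mod + p
  dickson-root = begin
    a * P * (a * P)                         ≡⟨ regroup a P R ⟩
    a * ((a * P * P - + 2 * R) + + 2 * R)   ≈⟨ mod-*-congˡ a (mod-+-cong (mod-sym root) mod-refl) ⟩
    a * (R * x + + 2 * R)                   ≡⟨ factor a R x ⟩
    a * R * (x + + 2)                       ∎
    where
    regroup : ∀ a P R → a * P * (a * P) ≡ a * ((a * P * P - + 2 * R) + + 2 * R)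
    regroup = solve-∀
    factor : ∀ a R x → a * (R * x + + 2 * R) ≡ a * R * (x + + 2)
    factor = solve-∀

  x≡-2 : a * P * P ≡ 0ℤ mod + p → x ≡ - + 2 mod + p
  x≡-2 aPP≡0 = *-cancelˡ-mod R≢0 (begin
    R * x                 ≈⟨ root ⟩
    a * P * P - + 2 * R   ≈⟨ mod-+-cong aPP≡0 mod-refl ⟩
    0ℤ - + 2 * R          ≡⟨ factor R ⟩
    R * - + 2             ∎)
    where
    factor : ∀ R → 0ℤ - + 2 * R ≡ R * - + 2
    factor = solve-∀

  open DicksonChebyshev (a * P) (a * R) x dickson-root

  module _ (a≢0 : ¬ a ≡ 0ℤ mod + p) where

    aR≢0 : ¬ a * R ≡ 0ℤ mod + p
    aR≢0 = *-≢0 a≢0 R≢0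

    DicksonCond⇔ChebCond : ∀ s → DicksonCond (a * P) (a * R) s p ⇔ ChebCond s x p
    DicksonCond⇔ChebCond zero = ∃-unit-multiple-∣⇔ (^-≢0 aR≢0) L-odd
    DicksonCond⇔ChebCond (suc zero) with p ℕD.∣? ∣ P ∣
    ... | yes p∣P =
      mk⇔ (λ _ → Equivalence.from (ChebCond-at-−2 (x≡-2 aPP≡0) 1) refl) (λ _ → 0 , ≡0⇒∣ K₁≡0)
      where
      aP≡0 : a * P ≡ 0ℤ mod + p
      aP≡0 = mod-trans (mod-*-congˡ a (∣⇒≡0 p∣P)) (mod-reflexive (ℤ.*-zeroʳ a))
      aPP≡0 : a * P * P ≡ 0ℤ mod + p
      aPP≡0 = mod-*-cong aP≡0 (∣⇒≡0 p∣P)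
      K₁≡0 : K (a * P) (a * R) 1 ≡ 0ℤ mod + p
      K₁≡0 = mod-trans (K-odd 0) (mod-*-cong (mod-*-cong aP≡0 mod-refl) mod-refl)
    ... | no p∤P =
      ∃-unit-multiple-∣⇔ (λ k → *-≢0 (*-≢0 a≢0 (p∤P ∘ ≡0⇒∣)) (^-≢0 aR≢0 k))
        (λ k → reindex (K (a * P) (a * R)) (ℕ.*-identityˡ (odd k)) (K-odd k))
    DicksonCond⇔ChebCond (suc (suc j)) =
      ∃-unit-multiple-∣⇔ (λ k → ^-≢0 aR≢0 (2 ℕ.^ j ℕ.* odd k))
        (λ k → reindex (K (a * P) (a * R)) (ℕ.*-assoc 2 (2 ℕ.^ j) (odd k))
                       (K-even (2 ℕ.^ j ℕ.* odd k)))

  ΠTQ-condition⇔ChebCond : ∀ s →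
    ((+ p ∣ a × s ≡ 1) ⊎ (¬ (+ p ∣ a) × DicksonCond (a * P) (a * R) s p)) ⇔ ChebCond s x p
  ΠTQ-condition⇔ChebCond s with p ℕD.∣? ∣ a ∣
  ... | yes p∣a = ⇔.trans
    (mk⇔ [ proj₂ , (λ (p∤a , _) → ⊥-elim (p∤a p∣a)) ]′ (λ s≡1 → inj₁ (p∣a , s≡1)))
    (⇔.sym (ChebCond-at-−2 (x≡-2 aPP≡0) s))
    where
    a≡0 : a ≡ 0ℤ mod + p
    a≡0 = ∣⇒≡0 p∣a
    aPP≡0 : a * P * P ≡ 0ℤ mod + p
    aPP≡0 = mod-*-cong (mod-*-cong a≡0 mod-refl) mod-refl
  ... | no p∤a = ⇔.trans
    (mk⇔ [ ⊥-elim ∘ p∤a ∘ proj₁ , proj₂ ]′ (λ cond → inj₂ (p∤a , cond)))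
    (DicksonCond⇔ChebCond (p∤a ∘ ≡0⇒∣) s)

module Membership (T Q a P R : ℤ) .{{_ : NonZero Q}}
  (gcd[P,R]≡1 : gcd P R ≡ 1ℤ) (gcd[a,R]≡1 : gcd a R ≡ 1ℤ) (T²R≡aP²Q : T * T * R ≡ a * P * P * Q)
  {p : ℕ} (odd-prime : OddPrime p) (s : ℕ) where

  open PrimeModulus (proj₁ odd-prime)

  q : ℚ
  q = qOf T Q

  Z : ℤ
  Z = a * P * P - + 2 * R

  cR≡dZ : ↥ q * R ≡ ↧ q * Z
  cR≡dZ = qOf-cross-R T Q a P R T²R≡aP²Q

  d≡0⇔R≡0 : (↧ q ≡ 0ℤ mod + p) ⇔ (R ≡ 0ℤ mod + p)
  d≡0⇔R≡0 = denominator≡0⇔ q a P gcd[P,R]≡1 gcd[a,R]≡1 cR≡dZ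

  ΠTQ⇒Πq : ΠTQ T Q a P R s p → Πq q s p
  ΠTQ⇒Πq (_ , p∤R , condition) =
    odd-prime , d≢0 ∘ ∣⇒≡0 , x , mod⇒∣ dx≡c , Equivalence.to (ΠTQ-condition⇔ChebCond s) condition
    where
    R≢0 : ¬ R ≡ 0ℤ mod + p
    R≢0 = p∤R ∘ ≡0⇒∣
    d≢0 : ¬ ↧ q ≡ 0ℤ mod + p
    d≢0 = R≢0 ∘ Equivalence.to d≡0⇔R≡0
    x : ℤ
    x = proj₁ (linear-root Z R≢0)
    root : R * x ≡ Z mod + p
    root = proj₂ (linear-root Z R≢0)
    dx≡c : ↧ q * x ≡ ↥ q mod + p
    dx≡c = Equivalence.from (fraction-root⇔ x cR≡dZ R≢0 d≢0) root
    open AtRoot a P R x odd-prime R≢0 root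

  Πq⇒ΠTQ : Πq q s p → ΠTQ T Q a P R s p
  Πq⇒ΠTQ (_ , p∤d , x , p∣dx-c , cheb) =
    odd-prime , R≢0 ∘ ∣⇒≡0 , Equivalence.from (ΠTQ-condition⇔ChebCond s) cheb
    where
    d≢0 : ¬ ↧ q ≡ 0ℤ mod + p
    d≢0 = p∤d ∘ ≡0⇒∣
    R≢0 : ¬ R ≡ 0ℤ mod + p
    R≢0 = d≢0 ∘ Equivalence.from d≡0⇔R≡0
    dx≡c : ↧ q * x ≡ ↥ q mod + p
    dx≡c = ∣⇒mod p∣dx-c
    root : R * x ≡ Z mod + p
    root = Equivalence.to (fraction-root⇔ x cR≡dZ R≢0 d≢0) dx≡c
    open AtRoot a P R x odd-prime R≢0 root

theorem21 : (T Q a P R : ℤ) → .{{_ : NonZero Q}} →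
    a ≢ 0ℤ → SquareFree a → R ≢ 0ℤ →
    gcd P R ≡ 1ℤ → gcd a R ≡ 1ℤ →
    T * T * R ≡ a * P * P * Q →
    (s p : ℕ) →
      (ΠTQ T Q a P R s p → Πq (qOf T Q) s p) × (Πq (qOf T Q) s p → ΠTQ T Q a P R s p)
theorem21 T Q a P R _ _ _ gcd[P,R]≡1 gcd[a,R]≡1 T²R≡aP²Q s p =
  (λ Π → ΠTQ⇒Πq (proj₁ Π) s Π) , (λ Π → Πq⇒ΠTQ (proj₁ Π) s Π)
  where
  open Membership T Q a P R gcd[P,R]≡1 gcd[a,R]≡1 T²R≡aP²Q
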